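{- The systems $\mathsf{NEL}\cup\{\mathsf{i}\uparrow\}$ and $\mathsf{SNEL}\cup\{\circ\downarrow\}$ are strongly equivalent.
   Context: Atoms: countably many atoms $a,b,\dots$, each atom $a$ having a dual atom $\bar a$ with $\bar{\bar a}=a$. Structures are generated by $S::= a\mid \circ \mid [S,\dots,S]\mid (S,\dots,S)\mid \langle S;\dots;S\rangle \mid ?S\mid !S\mid \bar S$ (par, tensor, seq with at least one argument; unit $\circ$ not an atom), identified modulo the least congruence $=$ making par, tensor, seq associative, par and tensor commutative, $\circ$ a unit for all three, $[R]=(R)=\langle R\rangle=R$, with $\bar\circ=\circ$, $\overline{[R_1,\dots,R_h]}=(\bar R_1,\dots,\bar R_h)$, $\overline{(R_1,\dots,R_h)}=[\bar R_1,\dots,\bar R_h]$, $\overline{\langle R_1;\dots;R_h\rangle}=\langle\bar R_1;\dots;\bar R_h\rangle$, $\overline{?R}=!\bar R$, $\overline{!R}=?\bar R$, $\bar{\bar R}=R$. A context $S\{\;\}$ is a structure with one hole not under negation; $S[R,T]$ abbreviates $S\{[R,T]\}$ etc. An inference rule has a premise and a conclusion, one of which (but not both) may be missing. A derivation in a rule set is a finite vertical chain of rule instances (each conclusion equal modulo $=$ to the next premise), possibly a single structure; top = premise (absent if the top rule has no premise), bottom = conclusion. System $\mathsf{SNEL}$ (premise $\Rightarrow$ conclusion): $\mathsf{ai}\downarrow$: $S\{\circ\}\Rightarrow S[a,\bar a]$; $\mathsf{ai}\uparrow$: $S(a,\bar a)\Rightarrow S\{\circ\}$; $\mathsf{s}$: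 $S([R,U],T)\Rightarrow S[(R,T),U]$; $\mathsf{q}\downarrow$: $S\langle[R,U];[T,V]\rangle\Rightarrow S[\langle R;T\rangle,\langle U;V\rangle]$; $\mathsf{q}\uparrow$: $S(\langle R;U\rangle,\langle T;V\rangle)\Rightarrow S\langle(R,T);(U,V)\rangle$; $\mathsf{p}\downarrow$: $S\{![R,T]\}\Rightarrow S[!R,?T]$; $\mathsf{p}\uparrow$: $S(?R,!T)\Rightarrow S\{?(R,T)\}$; $\mathsf{e}\downarrow$: $S\{\circ\}\Rightarrow S\{!\circ\}$; $\mathsf{e}\uparrow$: $S\{?\circ\}\Rightarrow S\{\circ\}$; $\mathsf{w}\downarrow$: $S\{\circ\}\Rightarrow S\{?R\}$; $\mathsf{w}\uparrow$: $S\{!R\}\Rightarrow S\{\circ\}$; $\mathsf{b}\downarrow$: $S[?R,R]\Rightarrow S\{?R\}$; $\mathsf{b}\uparrow$: $S\{!R\}\Rightarrow S(!R,R)$; $\mathsf{g}\downarrow$: $S\{??R\}\Rightarrow S\{?R\}$; $\mathsf{g}\uparrow$: $S\{!R\}\Rightarrow S\{!!R\}$. The unit rule $\circ\downarrow$ has no premise and conclusion $\circ$. System $\mathsf{NEL}=\{\circ\downarrow,\mathsf{ai}\downarrow,\mathsf{e}\downarrow,\mathsf{s},\mathsf{q}\downarrow,\mathsf{p}\downarrow,\mathsf{w}\downarrow,\mathsf{b}\downarrow,\mathsf{g}\downarrow\}$. Cut $\mathsf{i}\uparrow$: $S(R,\bar R)\Rightarrow S\{\circ\}$ for arbitrary $R$.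 Two systems $\mathcal X,\mathcal X'$ are strongly equivalent if for every derivation in $\mathcal X$ with premise $T$ and conclusion $R$ there is a derivation in $\mathcal X'$ with premise $T$ and conclusion $R$, and vice versa. -}

module Defs where

open import Data.Nat using (ℕ)
open import Data.Bool using (Bool; not)
open import Data.Product using (Σ; _×_; _,_)
open import Data.Maybe using (Maybe; just; nothing)
open import Data.Unit using (⊤)
open import Data.Empty using (⊥)

Atom : Set
Atom = ℕ × Bool

dual : Atom → Atom
dual (n , b) = (n , not b)

-- Structures (raw syntax).  n-ary par/tensor/seq (h ≥ 1) are represented
-- with binary constructors; modulo associativity and [R] = (R) = ⟨R⟩ = R
-- this is the same set of structures.

data Str : Set where
  atom   : Atom → Str
  unit   : Str                  -- ∘
  par    : Str → Str → Str      -- [R , T]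
  tensor : Str → Str → Str      -- (R , T)
  seq    : Str → Str → Str      -- ⟨R ; T⟩
  why    : Str → Str
  bang   : Str → Str
  neg    : Str → Str            -- R̄

infix 4 _≃_
data _≃_ : Str → Str → Set where
  ≃-refl  : ∀ {R} → R ≃ R
  ≃-sym   : ∀ {R T} → R ≃ T → T ≃ R
  ≃-trans : ∀ {R T U} → R ≃ T → T ≃ U → R ≃ U
  par-cong    : ∀ {R R' T T'} → R ≃ R' → T ≃ T' → par R T ≃ par R' T'
  tensor-cong : ∀ {R R' T T'} → R ≃ R' → T ≃ T' → tensor R T ≃ tensor R' T'
  seq-cong    : ∀ {R R' T T'} → R ≃ R' → T ≃ T' → seq R T ≃ seq R' T'
  why-cong    : ∀ {R R'} → R ≃ R' → why R ≃ why R'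
  bang-cong   : ∀ {R R'} → R ≃ R' → bang R ≃ bang R'
  neg-cong    : ∀ {R R'} → R ≃ R' → neg R ≃ neg R'
  par-assoc    : ∀ {R T U} → par (par R T) U ≃ par R (par T U)
  tensor-assoc : ∀ {R T U} → tensor (tensor R T) U ≃ tensor R (tensor T U)
  seq-assoc    : ∀ {R T U} → seq (seq R T) U ≃ seq R (seq T U)
  par-comm    : ∀ {R T} → par R T ≃ par T R
  tensor-comm : ∀ {R T} → tensor R T ≃ tensor T R
  par-unit     : ∀ {R} → par unit R ≃ R
  tensor-unit  : ∀ {R} → tensor unit R ≃ R
  seq-unitˡ    : ∀ {R} → seq unit R ≃ R
  seq-unitʳ    : ∀ {R} → seq R unit ≃ R
  neg-atom   : ∀ {a} → neg (atom a) ≃ atom (dual a)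
  neg-unit   : neg unit ≃ unit
  neg-par    : ∀ {R T} → neg (par R T) ≃ tensor (neg R) (neg T)
  neg-tensor : ∀ {R T} → neg (tensor R T) ≃ par (neg R) (neg T)
  neg-seq    : ∀ {R T} → neg (seq R T) ≃ seq (neg R) (neg T)
  neg-why    : ∀ {R} → neg (why R) ≃ bang (neg R)
  neg-bang   : ∀ {R} → neg (bang R) ≃ why (neg R)
  neg-neg    : ∀ {R} → neg (neg R) ≃ R

-- Contexts: one hole, not under negation.

data Ctx : Set where
  hole    : Ctx
  parL    : Ctx → Str → Ctx
  parR    : Str → Ctx → Ctx
  tensorL : Ctx → Str → Ctx
  tensorR : Str → Ctx → Ctx
  seqL    : Ctx → Str → Ctx
  seqR    : Str → Ctx → Ctx
  whyC    : Ctx → Ctx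
  bangC   : Ctx → Ctx

_⟦_⟧ : Ctx → Str → Str
hole        ⟦ R ⟧ = R
parL C T    ⟦ R ⟧ = par (C ⟦ R ⟧) T
parR T C    ⟦ R ⟧ = par T (C ⟦ R ⟧)
tensorL C T ⟦ R ⟧ = tensor (C ⟦ R ⟧) T
tensorR T C ⟦ R ⟧ = tensor T (C ⟦ R ⟧)
seqL C T    ⟦ R ⟧ = seq (C ⟦ R ⟧) T
seqR T C    ⟦ R ⟧ = seq T (C ⟦ R ⟧)
whyC C      ⟦ R ⟧ = why (C ⟦ R ⟧)
bangC C     ⟦ R ⟧ = bang (C ⟦ R ⟧)

data RuleName : Set where
  unit↓ ai↓ ai↑ s q↓ q↑ p↓ p↑ e↓ e↑ w↓ w↑ b↓ b↑ g↓ g↑ i↑ : RuleName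

data Sch : RuleName → Maybe Str → Maybe Str → Set where
  unit↓ : Sch unit↓ nothing (just unit)
  ai↓ : ∀ S a → Sch ai↓ (just (S ⟦ unit ⟧)) (just (S ⟦ par (atom a) (atom (dual a)) ⟧))
  ai↑ : ∀ S a → Sch ai↑ (just (S ⟦ tensor (atom a) (atom (dual a)) ⟧)) (just (S ⟦ unit ⟧))
  s   : ∀ S R T U → Sch s (just (S ⟦ tensor (par R U) T ⟧)) (just (S ⟦ par (tensor R T) U ⟧))
  q↓  : ∀ S R T U V → Sch q↓ (just (S ⟦ seq (par R U) (par T V) ⟧))
                              (just (S ⟦ par (seq R T) (seq U V) ⟧))
  q↑  : ∀ S R T U V → Sch q↑ (just (S ⟦ tensor (seq R U) (seq T V) ⟧))
                              (just (S ⟦ seq (tensor R T) (tensor U V) ⟧))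
  p↓  : ∀ S R T → Sch p↓ (just (S ⟦ bang (par R T) ⟧)) (just (S ⟦ par (bang R) (why T) ⟧))
  p↑  : ∀ S R T → Sch p↑ (just (S ⟦ tensor (why R) (bang T) ⟧)) (just (S ⟦ why (tensor R T) ⟧))
  e↓  : ∀ S → Sch e↓ (just (S ⟦ unit ⟧)) (just (S ⟦ bang unit ⟧))
  e↑  : ∀ S → Sch e↑ (just (S ⟦ why unit ⟧)) (just (S ⟦ unit ⟧))
  w↓  : ∀ S R → Sch w↓ (just (S ⟦ unit ⟧)) (just (S ⟦ why R ⟧))
  w↑  : ∀ S R → Sch w↑ (just (S ⟦ bang R ⟧)) (just (S ⟦ unit ⟧))
  b↓  : ∀ S R → Sch b↓ (just (S ⟦ par (why R) R ⟧)) (just (S ⟦ why R ⟧))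
  b↑  : ∀ S R → Sch b↑ (just (S ⟦ bang R ⟧)) (just (S ⟦ tensor (bang R) R ⟧))
  g↓  : ∀ S R → Sch g↓ (just (S ⟦ why (why R) ⟧)) (just (S ⟦ why R ⟧))
  g↑  : ∀ S R → Sch g↑ (just (S ⟦ bang R ⟧)) (just (S ⟦ bang (bang R) ⟧))
  i↑  : ∀ S R → Sch i↑ (just (S ⟦ tensor R (neg R) ⟧)) (just (S ⟦ unit ⟧))

data _≃ₘ_ : Maybe Str → Maybe Str → Set where
  nothing≃ : nothing ≃ₘ nothing
  just≃    : ∀ {R T} → R ≃ T → just R ≃ₘ just T

-- Since structures are identified modulo =, a rule instance is a
-- schematic instance up to = on premise and conclusion.
Inst : RuleName → Maybe Str → Maybe Str → Set
Inst r p c = Σ (Maybe Str) λ p₀ → Σ (Maybe Str) λ c₀ → Sch r p₀ c₀ × p ≃ₘ p₀ × c ≃ₘ c₀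

System : Set₁
System = RuleName → Set

data Chain (X : System) : Maybe Str → Maybe Str → Set where
  one  : ∀ {p c} r → X r → Inst r p c → Chain X p c
  snoc : ∀ {p c q} → Chain X p (just c) → ∀ r → X r → Inst r (just c) q → Chain X p q

data Deriv (X : System) : Maybe Str → Maybe Str → Set where
  triv  : ∀ S → Deriv X (just S) (just S)
  chain : ∀ {p c} → Chain X p c → Deriv X p c

StronglyEquivalent : System → System → Set
StronglyEquivalent X X' =
  (∀ T R → Deriv X T R → Deriv X' T R) × (∀ T R → Deriv X' T R → Deriv X T R)

NEL∪i↑ : System
NEL∪i↑ unit↓ = ⊤
NEL∪i↑ ai↓ = ⊤
NEL∪i↑ e↓ = ⊤
NEL∪i↑ s = ⊤
NEL∪i↑ q↓ = ⊤
NEL∪i↑ p↓ = ⊤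
NEL∪i↑ w↓ = ⊤
NEL∪i↑ b↓ = ⊤
NEL∪i↑ g↓ = ⊤
NEL∪i↑ i↑ = ⊤
NEL∪i↑ _ = ⊥

SNEL∪unit↓ : System
SNEL∪unit↓ i↑ = ⊥
SNEL∪unit↓ _ = ⊤

-- General cut reduces to atomic cut: by induction on R, the cut on R is built from cuts on the
-- immediate substructures using s, q↑, p↑ and e↑, so SNEL ∪ {∘↓} derives i↑. Dually, the
-- identity [R, R̄] is derivable from ∘ in NEL using ai↓, s, q↓, e↓ and p↓. With identity and
-- cut available, every up-rule A ⇒ B is obtained by contraposition from the down-rule B̄ ⇒ Ā:
-- T = (T, [R, R̄]) ⇒ [(T, R̄), R] ⇒ [(T, T̄), R] ⇒ R, when R̄ ⇒ T̄ is the down-rule.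
module Submission where

open import Defs
open import Data.Product using (_,_)
open import Data.Maybe using (just)
open import Data.Unit using (tt)

infixr 5 _∙_
_∙_ : ∀ {R T U} → R ≃ T → T ≃ U → R ≃ U
_∙_ = ≃-trans

⟦⟧-cong : ∀ S {R T} → R ≃ T → S ⟦ R ⟧ ≃ S ⟦ T ⟧
⟦⟧-cong hole          e = e
⟦⟧-cong (parL S T)    e = par-cong (⟦⟧-cong S e) ≃-refl
⟦⟧-cong (parR T S)    e = par-cong ≃-refl (⟦⟧-cong S e)
⟦⟧-cong (tensorL S T) e = tensor-cong (⟦⟧-cong S e) ≃-refl
⟦⟧-cong (tensorR T S) e = tensor-cong ≃-refl (⟦⟧-cong S e)
⟦⟧-cong (seqL S T)    e = seq-cong (⟦⟧-cong S e) ≃-refl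
⟦⟧-cong (seqR T S)    e = seq-cong ≃-refl (⟦⟧-cong S e)
⟦⟧-cong (whyC S)      e = why-cong (⟦⟧-cong S e)
⟦⟧-cong (bangC S)     e = bang-cong (⟦⟧-cong S e)

infixr 9 _∘ᶜ_
_∘ᶜ_ : Ctx → Ctx → Ctx
hole        ∘ᶜ C = C
parL S T    ∘ᶜ C = parL (S ∘ᶜ C) T
parR T S    ∘ᶜ C = parR T (S ∘ᶜ C)
tensorL S T ∘ᶜ C = tensorL (S ∘ᶜ C) T
tensorR T S ∘ᶜ C = tensorR T (S ∘ᶜ C)
seqL S T    ∘ᶜ C = seqL (S ∘ᶜ C) T
seqR T S    ∘ᶜ C = seqR T (S ∘ᶜ C)
whyC S      ∘ᶜ C = whyC (S ∘ᶜ C)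
bangC S     ∘ᶜ C = bangC (S ∘ᶜ C)

⟦⟧-∘ᶜ : ∀ S C R → S ⟦ C ⟦ R ⟧ ⟧ ≃ (S ∘ᶜ C) ⟦ R ⟧
⟦⟧-∘ᶜ hole          C R = ≃-refl
⟦⟧-∘ᶜ (parL S T)    C R = par-cong (⟦⟧-∘ᶜ S C R) ≃-refl
⟦⟧-∘ᶜ (parR T S)    C R = par-cong ≃-refl (⟦⟧-∘ᶜ S C R)
⟦⟧-∘ᶜ (tensorL S T) C R = tensor-cong (⟦⟧-∘ᶜ S C R) ≃-refl
⟦⟧-∘ᶜ (tensorR T S) C R = tensor-cong ≃-refl (⟦⟧-∘ᶜ S C R)
⟦⟧-∘ᶜ (seqL S T)    C R = seq-cong (⟦⟧-∘ᶜ S C R) ≃-refl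
⟦⟧-∘ᶜ (seqR T S)    C R = seq-cong ≃-refl (⟦⟧-∘ᶜ S C R)
⟦⟧-∘ᶜ (whyC S)      C R = why-cong (⟦⟧-∘ᶜ S C R)
⟦⟧-∘ᶜ (bangC S)     C R = bang-cong (⟦⟧-∘ᶜ S C R)

record SchUpTo (r : RuleName) (P Q : Str) : Set where
  constructor sch-upto
  field
    {P₀ Q₀} : Str
    instance₀ : Sch r (just P₀) (just Q₀)
    premise≃ : P ≃ P₀
    conclusion≃ : Q ≃ Q₀

Sch-ctx : ∀ {r P Q} S → Sch r (just P) (just Q) → SchUpTo r (S ⟦ P ⟧) (S ⟦ Q ⟧)
Sch-ctx S (ai↓ C a)       = sch-upto (ai↓ (S ∘ᶜ C) a)       (⟦⟧-∘ᶜ S C _) (⟦⟧-∘ᶜ S C _)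
Sch-ctx S (ai↑ C a)       = sch-upto (ai↑ (S ∘ᶜ C) a)       (⟦⟧-∘ᶜ S C _) (⟦⟧-∘ᶜ S C _)
Sch-ctx S (s C R T U)     = sch-upto (s (S ∘ᶜ C) R T U)     (⟦⟧-∘ᶜ S C _) (⟦⟧-∘ᶜ S C _)
Sch-ctx S (q↓ C R T U V)  = sch-upto (q↓ (S ∘ᶜ C) R T U V)  (⟦⟧-∘ᶜ S C _) (⟦⟧-∘ᶜ S C _)
Sch-ctx S (q↑ C R T U V)  = sch-upto (q↑ (S ∘ᶜ C) R T U V)  (⟦⟧-∘ᶜ S C _) (⟦⟧-∘ᶜ S C _)
Sch-ctx S (p↓ C R T)      = sch-upto (p↓ (S ∘ᶜ C) R T)      (⟦⟧-∘ᶜ S C _) (⟦⟧-∘ᶜ S C _)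
Sch-ctx S (p↑ C R T)      = sch-upto (p↑ (S ∘ᶜ C) R T)      (⟦⟧-∘ᶜ S C _) (⟦⟧-∘ᶜ S C _)
Sch-ctx S (e↓ C)          = sch-upto (e↓ (S ∘ᶜ C))          (⟦⟧-∘ᶜ S C _) (⟦⟧-∘ᶜ S C _)
Sch-ctx S (e↑ C)          = sch-upto (e↑ (S ∘ᶜ C))          (⟦⟧-∘ᶜ S C _) (⟦⟧-∘ᶜ S C _)
Sch-ctx S (w↓ C R)        = sch-upto (w↓ (S ∘ᶜ C) R)        (⟦⟧-∘ᶜ S C _) (⟦⟧-∘ᶜ S C _)
Sch-ctx S (w↑ C R)        = sch-upto (w↑ (S ∘ᶜ C) R)        (⟦⟧-∘ᶜ S C _) (⟦⟧-∘ᶜ S C _)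
Sch-ctx S (b↓ C R)        = sch-upto (b↓ (S ∘ᶜ C) R)        (⟦⟧-∘ᶜ S C _) (⟦⟧-∘ᶜ S C _)
Sch-ctx S (b↑ C R)        = sch-upto (b↑ (S ∘ᶜ C) R)        (⟦⟧-∘ᶜ S C _) (⟦⟧-∘ᶜ S C _)
Sch-ctx S (g↓ C R)        = sch-upto (g↓ (S ∘ᶜ C) R)        (⟦⟧-∘ᶜ S C _) (⟦⟧-∘ᶜ S C _)
Sch-ctx S (g↑ C R)        = sch-upto (g↑ (S ∘ᶜ C) R)        (⟦⟧-∘ᶜ S C _) (⟦⟧-∘ᶜ S C _)
Sch-ctx S (i↑ C R)        = sch-upto (i↑ (S ∘ᶜ C) R)        (⟦⟧-∘ᶜ S C _) (⟦⟧-∘ᶜ S C _)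

Inst-ctx : ∀ {r P Q} S → Inst r (just P) (just Q) → Inst r (just (S ⟦ P ⟧)) (just (S ⟦ Q ⟧))
Inst-ctx S (_ , _ , inst , just≃ eP , just≃ eQ) with Sch-ctx S inst
... | sch-upto inst′ eP′ eQ′ =
  _ , _ , inst′ , just≃ (⟦⟧-cong S eP ∙ eP′) , just≃ (⟦⟧-cong S eQ ∙ eQ′)

module _ {X : System} where

  infixr 4 _++_ _⟫⟨_⟩_

  _++_ : ∀ {p R q} → Chain X p (just R) → Chain X (just R) q → Chain X p q
  d ++ one r x i      = snoc d r x i
  d ++ snoc d′ r x i  = snoc (d ++ d′) r x i

  Chain-ctx : ∀ {P Q} S → Chain X (just P) (just Q) → Chain X (just (S ⟦ P ⟧)) (just (S ⟦ Q ⟧))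
  Chain-ctx S (one r x i)    = one r x (Inst-ctx S i)
  Chain-ctx S (snoc d r x i) = snoc (Chain-ctx S d) r x (Inst-ctx S i)

  Chain-≃ˡ : ∀ {P P′ q} → P′ ≃ P → Chain X (just P) q → Chain X (just P′) q
  Chain-≃ˡ e (one r x (_ , _ , inst , just≃ eP , eq)) = one r x (_ , _ , inst , just≃ (e ∙ eP) , eq)
  Chain-≃ˡ e (snoc d r x i)                           = snoc (Chain-≃ˡ e d) r x i

  Chain-≃ʳ : ∀ {p Q Q′} → Chain X p (just Q) → Q′ ≃ Q → Chain X p (just Q′)
  Chain-≃ʳ (one r x (_ , _ , inst , ep , just≃ eQ)) e    = one r x (_ , _ , inst , ep , just≃ (e ∙ eQ))
  Chain-≃ʳ (snoc d r x (_ , _ , inst , ep , just≃ eQ)) e = snoc d r x (_ , _ , inst , ep , just≃ (e ∙ eQ))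

  _⟫⟨_⟩_ : ∀ {P Q Q′ R} → Chain X (just P) (just Q) → Q ≃ Q′ → Chain X (just Q′) (just R) →
           Chain X (just P) (just R)
  d ⟫⟨ e ⟩ d′ = d ++ Chain-≃ˡ e d′

  rule : ∀ {r P Q P₀ Q₀} → X r → Sch r (just P₀) (just Q₀) → P ≃ P₀ → Q ≃ Q₀ → Chain X (just P) (just Q)
  rule {r} x inst eP eQ = one r x (_ , _ , inst , just≃ eP , just≃ eQ)

  Chain-ctx-≃ₘ : ∀ {p c P Q} S → Chain X (just P) (just Q) →
                 p ≃ₘ just (S ⟦ P ⟧) → c ≃ₘ just (S ⟦ Q ⟧) → Chain X p c
  Chain-ctx-≃ₘ S d (just≃ eP) (just≃ eQ) = Chain-≃ʳ (Chain-≃ˡ eP (Chain-ctx S d)) eQ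

  at : ∀ {P Q P′} S → P′ ≃ S ⟦ P ⟧ → Chain X (just P) (just Q) → Chain X (just P′) (just (S ⟦ Q ⟧))
  at S e d = Chain-≃ˡ e (Chain-ctx S d)

  -- A derivation cannot be a bare equation between distinct structures; the switch
  -- instance ([∘, ∘], P) ⇒ [(∘, P), ∘] is a rule step whose premise and conclusion are = P.
  ≃⇒Chain : X s → ∀ {P Q} → P ≃ Q → Chain X (just P) (just Q)
  ≃⇒Chain x {P} e =
    rule x (s hole unit unit P)
      (≃-sym (tensor-comm ∙ tensor-unit ∙ par-unit))
      (≃-sym e ∙ ≃-sym (par-cong tensor-unit ≃-refl ∙ par-unit))

Chain-map : ∀ {X Y : System} → (∀ {p c} r → X r → Inst r p c → Chain Y p c) →
            ∀ {p c} → Chain X p c → Chain Y p c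
Chain-map f (one r x i)    = f r x i
Chain-map f (snoc d r x i) = Chain-map f d ++ f r x i

Deriv-map : ∀ {X Y : System} → (∀ {p c} r → X r → Inst r p c → Chain Y p c) →
            ∀ {p c} → Deriv X p c → Deriv Y p c
Deriv-map f (triv S)  = triv S
Deriv-map f (chain d) = chain (Chain-map f d)

i↑-derivable : ∀ R → Chain SNEL∪unit↓ (just (tensor R (neg R))) (just unit)
i↑-derivable (atom a) = rule tt (ai↑ hole a) (tensor-cong ≃-refl neg-atom) ≃-refl
i↑-derivable unit     = ≃⇒Chain tt (tensor-unit ∙ neg-unit)
i↑-derivable (par R T) =
  at (tensorL hole (neg T)) (tensor-cong ≃-refl neg-par ∙ ≃-sym tensor-assoc)
     (rule tt (s hole R (neg R) T) ≃-refl ≃-refl)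
  ⟫⟨ ≃-refl ⟩ at (tensorL (parL hole T) (neg T)) ≃-refl (i↑-derivable R)
  ⟫⟨ tensor-cong par-unit ≃-refl ⟩ i↑-derivable T
i↑-derivable (tensor R T) =
  at (tensorL hole T) (tensor-cong ≃-refl neg-tensor ∙ tensor-comm ∙ ≃-sym tensor-assoc)
     (rule tt (s hole (neg R) R (neg T)) ≃-refl ≃-refl)
  ⟫⟨ ≃-refl ⟩ at (tensorL (parL hole (neg T)) T) (⟦⟧-cong (tensorL (parL hole (neg T)) T) tensor-comm)
                 (i↑-derivable R)
  ⟫⟨ tensor-cong par-unit ≃-refl ∙ tensor-comm ⟩ i↑-derivable T
i↑-derivable (seq R T) = Chain-≃ʳ
  (rule tt (q↑ hole R (neg R) T (neg T)) (tensor-cong ≃-refl neg-seq) ≃-refl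
  ⟫⟨ ≃-refl ⟩ at (seqL hole (tensor T (neg T))) ≃-refl (i↑-derivable R)
  ⟫⟨ ≃-refl ⟩ at (seqR unit hole) ≃-refl (i↑-derivable T))
  (≃-sym seq-unitˡ)
i↑-derivable (why R) =
  rule tt (p↑ hole R (neg R)) (tensor-cong ≃-refl neg-why) ≃-refl
  ⟫⟨ ≃-refl ⟩ at (whyC hole) ≃-refl (i↑-derivable R)
  ⟫⟨ ≃-refl ⟩ rule tt (e↑ hole) ≃-refl ≃-refl
i↑-derivable (bang R) =
  rule tt (p↑ hole (neg R) R) (tensor-cong ≃-refl neg-bang ∙ tensor-comm) ≃-refl
  ⟫⟨ ≃-refl ⟩ at (whyC hole) (why-cong tensor-comm) (i↑-derivable R)
  ⟫⟨ ≃-refl ⟩ rule tt (e↑ hole) ≃-refl ≃-refl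
i↑-derivable (neg R) = Chain-≃ˡ (tensor-cong ≃-refl neg-neg ∙ tensor-comm) (i↑-derivable R)

i↓-derivable : ∀ R → Chain NEL∪i↑ (just unit) (just (par R (neg R)))
i↓-derivable (atom a) = rule tt (ai↓ hole a) ≃-refl (par-cong ≃-refl neg-atom)
i↓-derivable unit     = ≃⇒Chain tt (≃-sym (par-unit ∙ neg-unit))
i↓-derivable (par R T) = Chain-≃ʳ
  (i↓-derivable R
  ⟫⟨ par-cong ≃-refl (≃-sym (tensor-comm ∙ tensor-unit)) ⟩
     at (parR R (tensorR (neg R) hole)) ≃-refl (i↓-derivable T)
  ⟫⟨ ≃-refl ⟩ at (parR R hole) (par-cong ≃-refl (tensor-comm ∙ tensor-cong par-comm ≃-refl))
                 (rule tt (s hole (neg T) (neg R) T) ≃-refl ≃-refl))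
  (par-cong ≃-refl neg-par ∙ par-assoc ∙ par-cong ≃-refl (par-comm ∙ par-cong tensor-comm ≃-refl))
i↓-derivable (tensor R T) = Chain-≃ʳ
  (i↓-derivable R
  ⟫⟨ par-cong (≃-sym (tensor-comm ∙ tensor-unit)) ≃-refl ⟩
     at (parL (tensorR R hole) (neg R)) ≃-refl (i↓-derivable T)
  ⟫⟨ ≃-refl ⟩ at (parL hole (neg R)) (par-cong tensor-comm ≃-refl)
                 (rule tt (s hole T R (neg T)) ≃-refl ≃-refl))
  (par-cong ≃-refl neg-tensor ∙ par-cong tensor-comm par-comm ∙ ≃-sym par-assoc)
i↓-derivable (seq R T) = Chain-≃ʳ
  (at (seqL hole unit) (≃-sym seq-unitʳ) (i↓-derivable R)
  ⟫⟨ ≃-refl ⟩ at (seqR (par R (neg R)) hole) ≃-refl (i↓-derivable T)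
  ⟫⟨ ≃-refl ⟩ rule tt (q↓ hole R T (neg R) (neg T)) ≃-refl ≃-refl)
  (par-cong ≃-refl neg-seq)
i↓-derivable (why R) = Chain-≃ʳ
  (rule tt (e↓ hole) ≃-refl ≃-refl
  ⟫⟨ ≃-refl ⟩ at (bangC hole) ≃-refl (i↓-derivable R)
  ⟫⟨ ≃-refl ⟩ rule tt (p↓ hole (neg R) R) (bang-cong par-comm) ≃-refl)
  (par-cong ≃-refl neg-why ∙ par-comm)
i↓-derivable (bang R) = Chain-≃ʳ
  (rule tt (e↓ hole) ≃-refl ≃-refl
  ⟫⟨ ≃-refl ⟩ at (bangC hole) ≃-refl (i↓-derivable R)
  ⟫⟨ ≃-refl ⟩ rule tt (p↓ hole R (neg R)) ≃-refl ≃-refl)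
  (par-cong ≃-refl neg-bang)
i↓-derivable (neg R) = Chain-≃ʳ (i↓-derivable R) (par-cong ≃-refl neg-neg ∙ par-comm)

contrapose : ∀ {P Q R T} → Chain NEL∪i↑ (just P) (just Q) → neg R ≃ P → Q ≃ neg T →
             Chain NEL∪i↑ (just T) (just R)
contrapose {R = R} {T} d eP eQ =
  at (tensorR T hole) (≃-sym (tensor-comm ∙ tensor-unit)) (i↓-derivable R)
  ⟫⟨ ≃-refl ⟩ rule tt (s hole (neg R) T R) (tensor-comm ∙ tensor-cong par-comm ≃-refl) ≃-refl
  ⟫⟨ ≃-refl ⟩ at (parL (tensorL hole T) R) ≃-refl (Chain-≃ˡ eP d)
  ⟫⟨ ≃-refl ⟩ rule tt (i↑ (parL hole R) T)
                (par-cong (tensor-comm ∙ tensor-cong ≃-refl eQ) ≃-refl) (≃-sym par-unit)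

contrapose-rule : ∀ {r P Q R T} → NEL∪i↑ r → Sch r (just P) (just Q) → neg R ≃ P → Q ≃ neg T →
                  Chain NEL∪i↑ (just T) (just R)
contrapose-rule x inst eP eQ = contrapose (rule x inst ≃-refl ≃-refl) eP eQ

NEL∪i↑-rule-derivable : ∀ {p c} r → NEL∪i↑ r → Inst r p c → Chain SNEL∪unit↓ p c
NEL∪i↑-rule-derivable unit↓ _ i = one unit↓ tt i
NEL∪i↑-rule-derivable ai↓   _ i = one ai↓ tt i
NEL∪i↑-rule-derivable s     _ i = one s tt i
NEL∪i↑-rule-derivable q↓    _ i = one q↓ tt i
NEL∪i↑-rule-derivable p↓    _ i = one p↓ tt i
NEL∪i↑-rule-derivable e↓    _ i = one e↓ tt i
NEL∪i↑-rule-derivable w↓    _ i = one w↓ tt i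
NEL∪i↑-rule-derivable b↓    _ i = one b↓ tt i
NEL∪i↑-rule-derivable g↓    _ i = one g↓ tt i
NEL∪i↑-rule-derivable i↑    _ (_ , _ , i↑ S R , eP , eQ) = Chain-ctx-≃ₘ S (i↑-derivable R) eP eQ

SNEL∪unit↓-rule-derivable : ∀ {p c} r → SNEL∪unit↓ r → Inst r p c → Chain NEL∪i↑ p c
SNEL∪unit↓-rule-derivable unit↓ _ i = one unit↓ tt i
SNEL∪unit↓-rule-derivable ai↓   _ i = one ai↓ tt i
SNEL∪unit↓-rule-derivable s     _ i = one s tt i
SNEL∪unit↓-rule-derivable q↓    _ i = one q↓ tt i
SNEL∪unit↓-rule-derivable p↓    _ i = one p↓ tt i
SNEL∪unit↓-rule-derivable e↓    _ i = one e↓ tt i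
SNEL∪unit↓-rule-derivable w↓    _ i = one w↓ tt i
SNEL∪unit↓-rule-derivable b↓    _ i = one b↓ tt i
SNEL∪unit↓-rule-derivable g↓    _ i = one g↓ tt i
SNEL∪unit↓-rule-derivable ai↑   _ (_ , _ , ai↑ S a , eP , eQ) =
  Chain-ctx-≃ₘ S (rule tt (i↑ hole (atom a)) (tensor-cong ≃-refl (≃-sym neg-atom)) ≃-refl) eP eQ
SNEL∪unit↓-rule-derivable q↑    _ (_ , _ , q↑ S R T U V , eP , eQ) =
  Chain-ctx-≃ₘ S (contrapose-rule tt (q↓ hole (neg R) (neg U) (neg T) (neg V))
                  (neg-seq ∙ seq-cong neg-tensor neg-tensor)
                  (≃-sym (neg-tensor ∙ par-cong neg-seq neg-seq))) eP eQ
SNEL∪unit↓-rule-derivable p↑    _ (_ , _ , p↑ S R T , eP , eQ) =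
  Chain-ctx-≃ₘ S (contrapose-rule tt (p↓ hole (neg R) (neg T))
                  (neg-why ∙ bang-cong neg-tensor)
                  (≃-sym (neg-tensor ∙ par-cong neg-why neg-bang))) eP eQ
SNEL∪unit↓-rule-derivable e↑    _ (_ , _ , e↑ S , eP , eQ) =
  Chain-ctx-≃ₘ S (contrapose-rule tt (e↓ hole) neg-unit (≃-sym (neg-why ∙ bang-cong neg-unit))) eP eQ
SNEL∪unit↓-rule-derivable w↑    _ (_ , _ , w↑ S R , eP , eQ) =
  Chain-ctx-≃ₘ S (contrapose-rule tt (w↓ hole (neg R)) neg-unit (≃-sym neg-bang)) eP eQ
SNEL∪unit↓-rule-derivable b↑    _ (_ , _ , b↑ S R , eP , eQ) =
  Chain-ctx-≃ₘ S (contrapose-rule tt (b↓ hole (neg R))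
                  (neg-tensor ∙ par-cong neg-bang ≃-refl) (≃-sym neg-bang)) eP eQ
SNEL∪unit↓-rule-derivable g↑    _ (_ , _ , g↑ S R , eP , eQ) =
  Chain-ctx-≃ₘ S (contrapose-rule tt (g↓ hole (neg R))
                  (neg-bang ∙ why-cong neg-bang) (≃-sym neg-bang)) eP eQ

proposition2p11 : StronglyEquivalent NEL∪i↑ SNEL∪unit↓
proposition2p11 =
  (λ _ _ → Deriv-map NEL∪i↑-rule-derivable) , (λ _ _ → Deriv-map SNEL∪unit↓-rule-derivable)
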